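{- Let $n\ge3$. Under rowmotion on $\mathcal{IC}([n])$, the cardinality statistic $I\mapsto|I|$ is not homomesic. More precisely, the orbit $\{\emptyset,[n]\}$ has average cardinality $\frac n2$; for each $k$ with $1\le k<\frac n2$, the orbit of size $n+2$ containing $[1,k]=\{1,\dots,k\}$ has average cardinality $\frac{2k(n-k)+n}{n+2}$; and when $n$ is even, the orbit of size $\frac{n+2}{2}$ containing $[1,\frac n2]$ has average cardinality $\frac n2$.
   Context: $[n]$ is the chain $1<\cdots<n$ and $[i,j]=\{i,\dots,j\}$. A subset $I$ is interval-closed if whenever $x,y\in I$ and $x\le z\le y$, then $z\in I$; $\mathcal{IC}(P)$ is the set of interval-closed subsets. The toggle $t_x$ sends $I$ to $I\triangle\{x\}$ if this set is interval-closed, and to $I$ otherwise; rowmotion is $t_{x_1}\circ\cdots\circ t_{x_N}$ for a linear extension $(x_1,\dots,x_N)$ (so $t_{x_N}$ is applied first). A statistic is homomesic if its average over each orbit is the same constant for all orbits. -}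

module Defs where

open import Data.Nat using (ℕ; zero; suc; _+_; NonZero)
open import Data.Fin using (Fin; toℕ; _≤_; _≤?_)
open import Data.Fin.Properties using (all?)
open import Data.Fin.Subset using (Subset; _∈_; _∉_; ∣_∣; ⊥; ⊤)
open import Data.Fin.Subset.Properties using (_∈?_)
open import Data.Vec using (_[_]≔_; lookup)
open import Data.Bool using (Bool; true; false; not)
open import Data.List using (List; foldr; allFin)
open import Data.Integer using (+_)
open import Data.Rational using (ℚ; _/_)
open import Data.Product using (Σ; _×_; _,_)
open import Relation.Nullary using (Dec; yes; no; ¬_)
open import Relation.Nullary.Decidable using (_→-dec_)
open import Relation.Binary.PropositionalEquality using (_≡_; _≢_)
open import Function using (_∘_)

-- Subsets of the chain [n] = {1 < ... < n}; element i of [n] is (i-1) : Fin n,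
-- ordered by the usual order on Fin n.

IsIntervalClosed : ∀ {n} → Subset n → Set
IsIntervalClosed {n} I =
  ∀ (x y z : Fin n) → x ∈ I → y ∈ I → x ≤ z → z ≤ y → z ∈ I

isIntervalClosed? : ∀ {n} (I : Subset n) → Dec (IsIntervalClosed I)
isIntervalClosed? I =
  all? λ x → all? λ y → all? λ z →
    (x ∈? I) →-dec (y ∈? I) →-dec (x ≤? z) →-dec (z ≤? y) →-dec (z ∈? I)

flip : ∀ {n} → Fin n → Subset n → Subset n
flip x I = I [ x ]≔ not (lookup I x)

toggle : ∀ {n} → Fin n → Subset n → Subset n
toggle x I with isIntervalClosed? (flip x I)
... | yes _ = flip x I
... | no  _ = I

-- Rowmotion = t_{x_1} ∘ ... ∘ t_{x_n} for the (unique) linear extension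
-- (1,...,n) of the chain; t_n is applied first.
rowmotion : ∀ {n} → Subset n → Subset n
rowmotion {n} I = foldr toggle I (allFin n)

initialSegment : ∀ {n} → ℕ → Subset n
initialSegment {zero}  k = Data.Vec.[]
initialSegment {suc n} zero    = false Data.Vec.∷ initialSegment {n} zero
initialSegment {suc n} (suc k) = true Data.Vec.∷ initialSegment {n} k

iterate : ∀ {A : Set} → (A → A) → ℕ → A → A
iterate f zero    x = x
iterate f (suc k) x = f (iterate f k x)

IsOrbitSize : ∀ {A : Set} → (A → A) → A → ℕ → Set
IsOrbitSize f x m =
  NonZero m × iterate f m x ≡ x
    × (∀ j → 0 Data.Nat.< j → j Data.Nat.< m → iterate f j x ≢ x)

orbitCardSum : ∀ {n} → (Subset n → Subset n) → Subset n → ℕ → ℕ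
orbitCardSum f x zero    = 0
orbitCardSum f x (suc m) = orbitCardSum f x m + ∣ iterate f m x ∣

orbitAverageCard : ∀ {n} → (Subset n → Subset n) → Subset n → (m : ℕ) → .{{NonZero m}} → ℚ
orbitAverageCard f x m = (+ orbitCardSum f x m) / m

CardHomomesic : ℕ → Set
CardHomomesic n =
  Σ ℚ λ c → ∀ (I : Subset n) → IsIntervalClosed I →
    ∀ m → .{{_ : NonZero m}} → IsOrbitSize rowmotion I m →
      orbitAverageCard rowmotion I m ≡ c

-- Rowmotion toggles the positions n - 1, …, 0 of the chain in turn.  Tracking this sweep on an
-- interval [a, b) (positions counted from 0) shows that rowmotion translates a nonempty [a, b)
-- with b < n to [a + 1, b + 1), and sends [a, n) to [0, a).  Hence, for 2k < n, the orbit of [0, k) consists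
-- of the n - k + 1 translates of [0, k), of size k, followed by the k + 1 translates of [0, n - k),
-- of size n - k: it has n + 2 elements and total size 2k(n - k) + n.  For n = 2k the two halves
-- coincide, giving an orbit of size k + 1 and average n / 2, and ∅ and [n] form an orbit of
-- average n / 2, which differs from the average (3n - 2) / (n + 2) of the orbit of [0, 1).
module Submission where

open import Defs
open import Data.Nat using (ℕ; zero; suc; _+_; _*_; _∸_; _≤_; _<_; _⊓_; _⊔_; z≤n; s≤s; s≤s⁻¹; z<s; _≤?_; _<?_)
open import Data.Nat.Properties
open import Data.Nat.Tactic.RingSolver using (solve-∀)
open import Data.Fin as Fin using (Fin; toℕ; fromℕ<)
open import Data.Fin.Properties using (toℕ-injective; toℕ<n; toℕ-fromℕ<)
open import Data.Fin.Subset using (Subset; _∈_; ∣_∣; ⊥; ⊤)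
open import Data.Fin.Subset.Properties using (∣⊥∣≡0; ∣⊤∣≡n)
open import Data.Vec using (lookup; tabulate; _∷_)
open import Data.Vec.Properties using (lookup∘tabulate; tabulate∘lookup; tabulate-cong; lookup∘update; lookup∘update′; []=⇒lookup; lookup⇒[]=; lookup-replicate)
open import Data.Bool using (Bool; true; false; not; if_then_else_)
import Data.List as List
open import Data.Product using (_×_; _,_; proj₁; proj₂)
open import Function using (_∘_; id; mk⇔)
open import Relation.Nullary using (Dec; yes; no; ¬_; does; proof; contradiction)
open import Relation.Nullary.Reflects using (Reflects; invert)
open import Relation.Nullary.Decidable using (_×-dec_; dec-true; dec-false; does-⇔)
open import Relation.Binary.Definitions using (tri<; tri≈; tri>)
open import Relation.Binary.PropositionalEquality
open import Data.Integer using (+_)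
open import Data.Integer.Properties using (pos-*)
open import Data.Rational using (_/_)
open import Data.Rational.Properties using (fromℚᵘ-cong; normalize-injective-≃)
open import Data.Rational.Unnormalised using (mkℚᵘ; *≡*)

subset-ext : ∀ {n} {S T : Subset n} → (∀ i → lookup S i ≡ lookup T i) → S ≡ T
subset-ext {S = S} {T} h = trans (sym (tabulate∘lookup S)) (trans (tabulate-cong h) (tabulate∘lookup T))

InInterval : ℕ → ℕ → ℕ → Set
InInterval p q k = p ≤ k × k < q

inInterval? : ∀ p q k → Dec (InInterval p q k)
inInterval? p q k = p ≤? k ×-dec k <? q

opaque
  inInterval : ℕ → ℕ → ℕ → Bool
  inInterval p q k = does (inInterval? p q k)

  inInterval-inside : ∀ {p q k} → p ≤ k → k < q → inInterval p q k ≡ true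
  inInterval-inside {p} {q} {k} p≤k k<q = dec-true (inInterval? p q k) (p≤k , k<q)

  inInterval-outside : ∀ {p q k} → ¬ InInterval p q k → inInterval p q k ≡ false
  inInterval-outside {p} {q} {k} = dec-false (inInterval? p q k)

  inInterval-sound : ∀ {p q k} → inInterval p q k ≡ true → InInterval p q k
  inInterval-sound {p} {q} {k} eq = invert (subst (Reflects _) eq (proof (inInterval? p q k)))

  inInterval-cong : ∀ {p q k p′ q′ k′} → (InInterval p q k → InInterval p′ q′ k′) → (InInterval p′ q′ k′ → InInterval p q k) →
                    inInterval p q k ≡ inInterval p′ q′ k′
  inInterval-cong {p} {q} {k} {p′} {q′} {k′} to from = does-⇔ (mk⇔ to from) (inInterval? p q k) (inInterval? p′ q′ k′)

inInterval-below : ∀ {p q k} → k < p → inInterval p q k ≡ false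
inInterval-below k<p = inInterval-outside (<⇒≱ k<p ∘ proj₁)

inInterval-above : ∀ {p q k} → q ≤ k → inInterval p q k ≡ false
inInterval-above q≤k = inInterval-outside (≤⇒≯ q≤k ∘ proj₂)

-- [p, q) = {p, …, q - 1} in 0-based positions, so the paper's [1, k] is interval 0 k.
interval : ∀ {n} → ℕ → ℕ → Subset n
interval p q = tabulate (inInterval p q ∘ toℕ)

lookup-interval : ∀ {n} p q (i : Fin n) → lookup (interval p q) i ≡ inInterval p q (toℕ i)
lookup-interval p q = lookup∘tabulate _

interval-isIntervalClosed : ∀ {n} p q → IsIntervalClosed (interval {n} p q)
interval-isIntervalClosed p q x y z x∈ y∈ x≤z z≤y = lookup⇒[]= z _ (begin
    lookup (interval p q) z  ≡⟨ lookup-interval p q z ⟩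
    inInterval p q (toℕ z)   ≡⟨ inInterval-inside (≤-trans (proj₁ (bounds x x∈)) x≤z) (≤-<-trans z≤y (proj₂ (bounds y y∈))) ⟩
    true                     ∎)
  where
  open ≡-Reasoning
  bounds : ∀ i → i ∈ interval p q → InInterval p q (toℕ i)
  bounds i i∈ = inInterval-sound (trans (sym (lookup-interval p q i)) ([]=⇒lookup i∈))

interval-empty : ∀ {n} p q → q ≤ p → interval {n} p q ≡ ⊥
interval-empty p q q≤p = subset-ext λ i → begin
  lookup (interval p q) i  ≡⟨ lookup-interval p q i ⟩
  inInterval p q (toℕ i)   ≡⟨ inInterval-outside (λ (p≤i , i<q) → <⇒≱ (<-≤-trans i<q q≤p) p≤i) ⟩
  false                    ≡⟨ lookup-replicate i false ⟨
  lookup ⊥ i               ∎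
  where open ≡-Reasoning

interval-full : ∀ {n} → interval {n} 0 n ≡ ⊤
interval-full {n} = subset-ext λ i → begin
  lookup (interval 0 n) i  ≡⟨ lookup-interval 0 n i ⟩
  inInterval 0 n (toℕ i)   ≡⟨ inInterval-inside z≤n (toℕ<n i) ⟩
  true                     ≡⟨ lookup-replicate i true ⟨
  lookup ⊤ i               ∎
  where open ≡-Reasoning

interval-suc : ∀ {n} p q → interval {suc n} (suc p) (suc q) ≡ false ∷ interval p q
interval-suc p q = cong₂ _∷_ (inInterval-below z<s)
  (tabulate-cong λ i → inInterval-cong (λ (p≤i , i<q) → s≤s⁻¹ p≤i , s≤s⁻¹ i<q) (λ (p≤i , i<q) → s≤s p≤i , s≤s i<q))

interval-zero-suc : ∀ {n} q → interval {suc n} 0 (suc q) ≡ true ∷ interval 0 q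
interval-zero-suc q = cong₂ _∷_ (inInterval-inside z≤n z<s)
  (tabulate-cong λ i → inInterval-cong (λ (_ , i<q) → z≤n , s≤s⁻¹ i<q) (λ (_ , i<q) → z≤n , s≤s i<q))

∣interval∣ : ∀ {n} p q → q ≤ n → ∣ interval {n} p q ∣ ≡ q ∸ p
∣interval∣ {n} p zero _ = begin
  ∣ interval {n} p 0 ∣  ≡⟨ cong ∣_∣ (interval-empty {n} p 0 z≤n) ⟩
  ∣ ⊥ {n} ∣             ≡⟨ ∣⊥∣≡0 n ⟩
  0                     ≡⟨ 0∸n≡0 p ⟨
  0 ∸ p                 ∎
  where open ≡-Reasoning
∣interval∣ {suc n} zero    (suc q) (s≤s q≤n) = trans (cong ∣_∣ (interval-zero-suc {n} q)) (cong suc (∣interval∣ 0 q q≤n))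
∣interval∣ {suc n} (suc p) (suc q) (s≤s q≤n) = trans (cong ∣_∣ (interval-suc {n} p q)) (∣interval∣ p q q≤n)

initialSegment≡interval : ∀ {n} k → initialSegment {n} k ≡ interval 0 k
initialSegment≡interval {zero}  k       = refl
initialSegment≡interval {suc n} zero    = begin
  false ∷ initialSegment 0  ≡⟨ cong (false ∷_) (trans (initialSegment≡interval 0) (interval-empty 0 0 z≤n)) ⟩
  ⊥                         ≡⟨ interval-empty 0 0 z≤n ⟨
  interval 0 0              ∎
  where open ≡-Reasoning
initialSegment≡interval {suc n} (suc k) = trans (cong (true ∷_) (initialSegment≡interval k)) (sym (interval-zero-suc k))

toggle-isIntervalClosed : ∀ {n} (x : Fin n) S → IsIntervalClosed (flip x S) → toggle x S ≡ flip x S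
toggle-isIntervalClosed x S ic with isIntervalClosed? (flip x S)
... | yes _  = refl
... | no ¬ic = contradiction ic ¬ic

toggle-¬isIntervalClosed : ∀ {n} (x : Fin n) S → ¬ IsIntervalClosed (flip x S) → toggle x S ≡ S
toggle-¬isIntervalClosed x S ¬ic with isIntervalClosed? (flip x S)
... | yes ic = contradiction ic ¬ic
... | no _   = refl

toggle-gap : ∀ {n} (x : Fin n) S (u m w : Fin n) → toℕ u ≤ toℕ m → toℕ m ≤ toℕ w →
             lookup (flip x S) u ≡ true → lookup (flip x S) w ≡ true → lookup (flip x S) m ≡ false →
             toggle x S ≡ S
toggle-gap x S u m w u≤m m≤w u∈ w∈ m∉ = toggle-¬isIntervalClosed x S λ ic →
  contradiction (trans (sym ([]=⇒lookup (ic u w m (lookup⇒[]= u _ u∈) (lookup⇒[]= w _ w∈) u≤m m≤w))) m∉) λ ()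

lookup-flip-interval-at : ∀ {n} (x : Fin n) p q → lookup (flip x (interval p q)) x ≡ not (inInterval p q (toℕ x))
lookup-flip-interval-at x p q = trans (lookup∘update x (interval p q) _) (cong not (lookup-interval p q x))

lookup-flip-interval-away : ∀ {n} (x i : Fin n) p q → toℕ i ≢ toℕ x → lookup (flip x (interval p q)) i ≡ inInterval p q (toℕ i)
lookup-flip-interval-away x i p q i≢x = trans (lookup∘update′ (i≢x ∘ cong toℕ) (interval p q) _) (lookup-interval p q i)

flip-interval : ∀ {n} (x : Fin n) p q p′ q′ →
                inInterval p′ q′ (toℕ x) ≡ not (inInterval p q (toℕ x)) →
                (∀ k → k ≢ toℕ x → inInterval p q k ≡ inInterval p′ q′ k) →
                flip x (interval p q) ≡ interval p′ q′
flip-interval x p q p′ q′ at away = subset-ext λ i → lookup-flip i (toℕ i ≟ toℕ x)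
  where
  lookup-flip : ∀ i → Dec (toℕ i ≡ toℕ x) → lookup (flip x (interval p q)) i ≡ lookup (interval p′ q′) i
  lookup-flip i (yes i≡x) rewrite toℕ-injective i≡x =
    trans (lookup-flip-interval-at x p q) (trans (sym at) (sym (lookup-interval p′ q′ x)))
  lookup-flip i (no i≢x) =
    trans (lookup-flip-interval-away x i p q i≢x) (trans (away (toℕ i) i≢x) (sym (lookup-interval p′ q′ i)))

toggle-interval : ∀ {n} (x : Fin n) p q p′ q′ → flip x (interval p q) ≡ interval p′ q′ → toggle x (interval p q) ≡ interval p′ q′
toggle-interval x p q p′ q′ eq =
  trans (toggle-isIntervalClosed x _ (subst IsIntervalClosed (sym eq) (interval-isIntervalClosed p′ q′))) eq

module _ {n} (x : Fin n) where

  private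
    c = toℕ x

  toggle-extendʳ : ∀ {p} → p ≤ c → toggle x (interval p c) ≡ interval p (suc c)
  toggle-extendʳ {p} p≤c = toggle-interval x p c p (suc c) (flip-interval x p c p (suc c)
    (trans (inInterval-inside p≤c ≤-refl) (cong not (sym (inInterval-above ≤-refl))))
    λ k k≢c → inInterval-cong (λ (p≤k , k<c) → p≤k , m<n⇒m<1+n k<c) (λ (p≤k , k≤c) → p≤k , ≤∧≢⇒< (s≤s⁻¹ k≤c) k≢c))

  toggle-shrinkʳ : ∀ {p} → p ≤ c → toggle x (interval p (suc c)) ≡ interval p c
  toggle-shrinkʳ {p} p≤c = toggle-interval x p (suc c) p c (flip-interval x p (suc c) p c
    (trans (inInterval-above ≤-refl) (cong not (sym (inInterval-inside p≤c ≤-refl))))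
    λ k k≢c → inInterval-cong (λ (p≤k , k≤c) → p≤k , ≤∧≢⇒< (s≤s⁻¹ k≤c) k≢c) (λ (p≤k , k<c) → p≤k , m<n⇒m<1+n k<c))

  toggle-extendˡ : ∀ {q} → c < q → toggle x (interval (suc c) q) ≡ interval c q
  toggle-extendˡ {q} c<q = toggle-interval x (suc c) q c q (flip-interval x (suc c) q c q
    (trans (inInterval-inside ≤-refl c<q) (cong not (sym (inInterval-below ≤-refl))))
    λ k k≢c → inInterval-cong (λ (c<k , k<q) → <⇒≤ c<k , k<q) (λ (c≤k , k<q) → ≤∧≢⇒< c≤k (k≢c ∘ sym) , k<q))

  toggle-shrinkˡ : ∀ {q} → c < q → toggle x (interval c q) ≡ interval (suc c) q
  toggle-shrinkˡ {q} c<q = toggle-interval x c q (suc c) q (flip-interval x c q (suc c) q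
    (trans (inInterval-below ≤-refl) (cong not (sym (inInterval-inside ≤-refl c<q))))
    λ k k≢c → inInterval-cong (λ (c≤k , k<q) → ≤∧≢⇒< c≤k (k≢c ∘ sym) , k<q) (λ (c<k , k<q) → <⇒≤ c<k , k<q))

  private
    lookup-flip-interval-fromℕ< : ∀ {k p q} (k<n : k < n) → k ≢ c → lookup (flip x (interval p q)) (fromℕ< k<n) ≡ inInterval p q k
    lookup-flip-interval-fromℕ< {p = p} {q} k<n k≢c =
      trans (lookup-flip-interval-away x _ p q (k≢c ∘ trans (sym (toℕ-fromℕ< k<n)))) (cong (inInterval p q) (toℕ-fromℕ< k<n))

  toggle-interior : ∀ {p q} → p < c → suc c < q → q ≤ n → toggle x (interval p q) ≡ interval p q
  toggle-interior {p} {q} p<c c+1<q q≤n = toggle-gap x _ (fromℕ< p<n) x (fromℕ< c+1<n)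
    (subst (_≤ c) (sym (toℕ-fromℕ< p<n)) (<⇒≤ p<c))
    (subst (c ≤_) (sym (toℕ-fromℕ< c+1<n)) (n≤1+n c))
    (trans (lookup-flip-interval-fromℕ< p<n (<⇒≢ p<c)) (inInterval-inside ≤-refl p<q))
    (trans (lookup-flip-interval-fromℕ< c+1<n (1+n≢n)) (inInterval-inside (<⇒≤ (m<n⇒m<1+n p<c)) c+1<q))
    (trans (lookup-flip-interval-at x p q) (cong not (inInterval-inside (<⇒≤ p<c) (<-trans (n<1+n c) c+1<q))))
    where
    p<q = <-trans p<c (<-trans (n<1+n c) c+1<q)
    p<n = <-≤-trans p<q q≤n
    c+1<n = <-≤-trans c+1<q q≤n

  toggle-beyondʳ : ∀ {p q} → p < q → q < c → toggle x (interval p q) ≡ interval p q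
  toggle-beyondʳ {p} {q} p<q q<c = toggle-gap x _ (fromℕ< p<n) (fromℕ< q<n) x
    (subst₂ _≤_ (sym (toℕ-fromℕ< p<n)) (sym (toℕ-fromℕ< q<n)) (<⇒≤ p<q))
    (subst (_≤ c) (sym (toℕ-fromℕ< q<n)) (<⇒≤ q<c))
    (trans (lookup-flip-interval-fromℕ< p<n (<⇒≢ (<-trans p<q q<c))) (inInterval-inside ≤-refl p<q))
    (trans (lookup-flip-interval-at x p q) (cong not (inInterval-above (<⇒≤ q<c))))
    (trans (lookup-flip-interval-fromℕ< q<n (<⇒≢ q<c)) (inInterval-above ≤-refl))
    where
    q<n = <-trans q<c (toℕ<n x)
    p<n = <-trans p<q q<n

  toggle-beyondˡ : ∀ {p q} → suc c < p → p < q → q ≤ n → toggle x (interval p q) ≡ interval p q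
  toggle-beyondˡ {p} {q} c+1<p p<q q≤n = toggle-gap x _ x (fromℕ< c+1<n) (fromℕ< p<n)
    (subst (c ≤_) (sym (toℕ-fromℕ< c+1<n)) (n≤1+n c))
    (subst₂ _≤_ (sym (toℕ-fromℕ< c+1<n)) (sym (toℕ-fromℕ< p<n)) (<⇒≤ c+1<p))
    (trans (lookup-flip-interval-at x p q) (cong not (inInterval-below (<-trans (n<1+n c) c+1<p))))
    (trans (lookup-flip-interval-fromℕ< p<n (<⇒≢ (<-trans (n<1+n c) c+1<p) ∘ sym)) (inInterval-inside ≤-refl p<q))
    (trans (lookup-flip-interval-fromℕ< c+1<n 1+n≢n) (inInterval-below c+1<p))
    where
    p<n = <-≤-trans p<q q≤n
    c+1<n = <-trans c+1<p p<n

foldr-tabulate-telescope : ∀ {a b} {A : Set a} {B : Set b} {n} (g : B → A → A) (f : Fin n → B) (S : ℕ → A) →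
                           (∀ x → g (f x) (S (suc (toℕ x))) ≡ S (toℕ x)) →
                           List.foldr g (S n) (List.tabulate f) ≡ S 0
foldr-tabulate-telescope {n = zero}  g f S step = refl
foldr-tabulate-telescope {n = suc n} g f S step =
  trans (cong (g (f Fin.zero)) (foldr-tabulate-telescope g (f ∘ Fin.suc) (S ∘ suc) (step ∘ Fin.suc))) (step Fin.zero)

rowmotion-telescope : ∀ {n} (S : ℕ → Subset n) → (∀ x → toggle x (S (suc (toℕ x))) ≡ S (toℕ x)) → rowmotion (S n) ≡ S 0
rowmotion-telescope = foldr-tabulate-telescope toggle id

toggle-interval-cong : ∀ {n} (x : Fin n) {p q p′ q′ r s r′ s′} → p ≡ r → q ≡ s → p′ ≡ r′ → q′ ≡ s′ →
                       toggle x (interval r s) ≡ interval r′ s′ → toggle x (interval p q) ≡ interval p′ q′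
toggle-interval-cong x refl refl refl refl t = t

rowmotion-wrap : ∀ {n} a → a ≤ n → rowmotion (interval {n} a n) ≡ interval 0 a
rowmotion-wrap {n} a a≤n = begin
  rowmotion (interval a n)  ≡⟨ cong rowmotion (cong₂ interval (m≥n⇒m⊓n≡n a≤n) (m≥n⇒m⊔n≡m a≤n)) ⟨
  rowmotion (S n)           ≡⟨ rowmotion-telescope S step ⟩
  interval 0 a              ∎
  where
  open ≡-Reasoning
  -- the state once positions n - 1, …, c have been toggled: [a, c) if a ≤ c, else [c, a)
  S : ℕ → Subset n
  S c = interval (c ⊓ a) (c ⊔ a)
  step : ∀ x → toggle x (S (suc (toℕ x))) ≡ S (toℕ x)
  step x with a ≤? toℕ x
  ... | yes a≤c = toggle-interval-cong x (m≥n⇒m⊓n≡n (m≤n⇒m≤1+n a≤c)) (m≥n⇒m⊔n≡m (m≤n⇒m≤1+n a≤c))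
                    (m≥n⇒m⊓n≡n a≤c) (m≥n⇒m⊔n≡m a≤c) (toggle-shrinkʳ x a≤c)
  ... | no a≰c  = toggle-interval-cong x (m≤n⇒m⊓n≡m c<a) (m≤n⇒m⊔n≡n c<a)
                    (m≤n⇒m⊓n≡m (<⇒≤ c<a)) (m≤n⇒m⊔n≡n (<⇒≤ c<a)) (toggle-extendˡ x c<a)
    where c<a = ≰⇒> a≰c

-- Where an endpoint y of the interval stands once positions n - 1, …, c have been toggled:
-- each endpoint moves up by one when the sweep reaches it.
bumpFrom : ℕ → ℕ → ℕ
bumpFrom c y = if does (y <? c) then y else suc y

bumpFrom-< : ∀ {c y} → y < c → bumpFrom c y ≡ y
bumpFrom-< {c} {y} y<c rewrite dec-true (y <? c) y<c = refl

bumpFrom-≥ : ∀ {c y} → c ≤ y → bumpFrom c y ≡ suc y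
bumpFrom-≥ {c} {y} c≤y rewrite dec-false (y <? c) (≤⇒≯ c≤y) = refl

rowmotion-shift : ∀ {n} a b → a < b → b < n → rowmotion (interval {n} a b) ≡ interval (suc a) (suc b)
rowmotion-shift {n} a b a<b b<n = begin
  rowmotion (interval a b)   ≡⟨ cong rowmotion (cong₂ interval (bumpFrom-< (<-trans a<b b<n)) (bumpFrom-< b<n)) ⟨
  rowmotion (S n)            ≡⟨ rowmotion-telescope S step ⟩
  S 0                        ≡⟨ cong₂ interval (bumpFrom-≥ z≤n) (bumpFrom-≥ z≤n) ⟩
  interval (suc a) (suc b)   ∎
  where
  open ≡-Reasoning
  S : ℕ → Subset n
  S c = interval (bumpFrom c a) (bumpFrom c b)
  step : ∀ x → toggle x (S (suc (toℕ x))) ≡ S (toℕ x)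
  step x with <-cmp b (toℕ x)
  ... | tri< b<c _ _ = toggle-interval-cong x (bumpFrom-< (m<n⇒m<1+n (<-trans a<b b<c))) (bumpFrom-< (m<n⇒m<1+n b<c))
                         (bumpFrom-< (<-trans a<b b<c)) (bumpFrom-< b<c) (toggle-beyondʳ x a<b b<c)
  ... | tri≈ _ refl _ = toggle-interval-cong x (bumpFrom-< (m<n⇒m<1+n a<b)) (bumpFrom-< (n<1+n b))
                          (bumpFrom-< a<b) (bumpFrom-≥ ≤-refl) (toggle-extendʳ x (<⇒≤ a<b))
  ... | tri> _ _ c<b with <-cmp a (toℕ x)
  ...   | tri< a<c _ _ = toggle-interval-cong x (bumpFrom-< (m<n⇒m<1+n a<c)) (bumpFrom-≥ c<b)
                           (bumpFrom-< a<c) (bumpFrom-≥ (<⇒≤ c<b)) (toggle-interior x a<c (s≤s c<b) b<n)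
  ...   | tri≈ _ refl _ = toggle-interval-cong x (bumpFrom-< (n<1+n a)) (bumpFrom-≥ c<b)
                            (bumpFrom-≥ ≤-refl) (bumpFrom-≥ (<⇒≤ c<b)) (toggle-shrinkˡ x (m<n⇒m<1+n a<b))
  ...   | tri> _ _ c<a = toggle-interval-cong x (bumpFrom-≥ c<a) (bumpFrom-≥ c<b)
                           (bumpFrom-≥ (<⇒≤ c<a)) (bumpFrom-≥ (<⇒≤ c<b)) (toggle-beyondˡ x (s≤s c<a) (s≤s a<b) b<n)

interval-≢ : ∀ {n p q p′ q′ k} → k < n → InInterval p q k → ¬ InInterval p′ q′ k → interval {n} p q ≢ interval p′ q′
interval-≢ {p = p} {q} {p′} {q′} {k} k<n (p≤k , k<q) k∉ eq = contradiction (begin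
  true                            ≡⟨ inInterval-inside p≤k k<q ⟨
  inInterval p q k                ≡⟨ lookup-interval-fromℕ< p q ⟨
  lookup (interval p q) i         ≡⟨ cong (λ S → lookup S i) eq ⟩
  lookup (interval p′ q′) i       ≡⟨ lookup-interval-fromℕ< p′ q′ ⟩
  inInterval p′ q′ k              ≡⟨ inInterval-outside k∉ ⟩
  false                           ∎) λ ()
  where
  open ≡-Reasoning
  i = fromℕ< k<n
  lookup-interval-fromℕ< : ∀ r s → lookup (interval r s) i ≡ inInterval r s k
  lookup-interval-fromℕ< r s = trans (lookup-interval r s i) (cong (inInterval r s) (toℕ-fromℕ< k<n))

iterate-+ : ∀ {A : Set} (f : A → A) i j x → iterate f (i + j) x ≡ iterate f i (iterate f j x)
iterate-+ f zero    j x = refl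
iterate-+ f (suc i) j x = cong f (iterate-+ f i j x)

orbitCardSum-+ : ∀ {n} (f : Subset n → Subset n) x i j →
                 orbitCardSum f x (i + j) ≡ orbitCardSum f x i + orbitCardSum f (iterate f i x) j
orbitCardSum-+ f x i zero    = trans (cong (orbitCardSum f x) (+-identityʳ i)) (sym (+-identityʳ _))
orbitCardSum-+ f x i (suc j) = begin
  orbitCardSum f x (i + suc j)                                              ≡⟨ cong (orbitCardSum f x) (+-suc i j) ⟩
  orbitCardSum f x (i + j) + ∣ iterate f (i + j) x ∣                          ≡⟨ cong₂ _+_ (orbitCardSum-+ f x i j) (cong ∣_∣ (trans (cong (λ t → iterate f t x) (+-comm i j)) (iterate-+ f j i x))) ⟩
  orbitCardSum f x i + orbitCardSum f (iterate f i x) j + ∣ iterate f j (iterate f i x) ∣ ≡⟨ +-assoc (orbitCardSum f x i) _ _ ⟩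
  orbitCardSum f x i + orbitCardSum f (iterate f i x) (suc j)               ∎
  where open ≡-Reasoning

orbitCardSum-const : ∀ {n} (f : Subset n → Subset n) x c i → (∀ t → t < i → ∣ iterate f t x ∣ ≡ c) →
                     orbitCardSum f x i ≡ i * c
orbitCardSum-const f x c zero    _     = refl
orbitCardSum-const f x c (suc i) ∣fᵗx∣ =
  trans (cong₂ _+_ (orbitCardSum-const f x c i (λ t t<i → ∣fᵗx∣ t (m<n⇒m<1+n t<i))) (∣fᵗx∣ i ≤-refl)) (+-comm (i * c) c)

iterate-rowmotion-initial : ∀ {n l} j → 0 < l → j + l ≤ n → iterate rowmotion j (interval {n} 0 l) ≡ interval j (j + l)
iterate-rowmotion-initial zero    _   _      = refl
iterate-rowmotion-initial {l = l} (suc j) 0<l j+l<n =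
  trans (cong rowmotion (iterate-rowmotion-initial j 0<l (<⇒≤ j+l<n))) (rowmotion-shift j (j + l) (m<m+n j 0<l) j+l<n)

iterate-rowmotion-initial-≢ : ∀ {n l l′} j → 0 < j → 0 < l → 0 < l′ → j + l ≤ n →
                              iterate rowmotion j (interval {n} 0 l) ≢ interval 0 l′
iterate-rowmotion-initial-≢ {l = l} j 0<j 0<l 0<l′ j+l≤n eq =
  interval-≢ (<-≤-trans 0<l (≤-trans (m≤n+m l j) j+l≤n)) (z≤n , 0<l′) (λ (j≤0 , _) → <⇒≱ 0<j j≤0)
    (sym (trans (sym (iterate-rowmotion-initial j 0<l j+l≤n)) eq))

iterate-rowmotion-initial-wrap : ∀ {n l} → 0 < l → l ≤ n → iterate rowmotion (suc (n ∸ l)) (interval {n} 0 l) ≡ interval 0 (n ∸ l)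
iterate-rowmotion-initial-wrap {n} {l} 0<l l≤n = begin
  rowmotion (iterate rowmotion (n ∸ l) (interval 0 l))  ≡⟨ cong rowmotion (iterate-rowmotion-initial (n ∸ l) 0<l (≤-reflexive n∸l+l≡n)) ⟩
  rowmotion (interval (n ∸ l) (n ∸ l + l))              ≡⟨ cong (rowmotion ∘ interval (n ∸ l)) n∸l+l≡n ⟩
  rowmotion (interval (n ∸ l) n)                        ≡⟨ rowmotion-wrap (n ∸ l) (m∸n≤m n l) ⟩
  interval 0 (n ∸ l)                                    ∎
  where
  open ≡-Reasoning
  n∸l+l≡n = m∸n+n≡m l≤n

orbitCardSum-initial : ∀ {n l} → 0 < l → l ≤ n → orbitCardSum rowmotion (interval {n} 0 l) (suc (n ∸ l)) ≡ suc (n ∸ l) * l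
orbitCardSum-initial {n} {l} 0<l l≤n = orbitCardSum-const rowmotion _ l _ λ t t≤n∸l →
  let t+l≤n = subst (t + l ≤_) (m∸n+n≡m l≤n) (+-monoˡ-≤ l (s≤s⁻¹ t≤n∸l)) in
  trans (cong ∣_∣ (iterate-rowmotion-initial t 0<l t+l≤n)) (trans (∣interval∣ t (t + l) t+l≤n) (m+n∸m≡n t l))

module InitialIntervalOrbit {n k : ℕ} (0<k : 0 < k) (k+k<n : k + k < n) where

  private
    d = n ∸ k
    x = interval {n} 0 k
    y = interval {n} 0 d
    k≤n = ≤-trans (m≤m+n k k) (<⇒≤ k+k<n)

    k+d≡n : k + d ≡ n
    k+d≡n = m+[n∸m]≡n k≤n

    k<d : k < d
    k<d = +-cancelˡ-< k k d (subst (k + k <_) (sym k+d≡n) k+k<n)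

    0<d = <-trans 0<k k<d

    2+n≡d+k : 2 + n ≡ suc d + suc k
    2+n≡d+k = cong suc (trans (cong suc (trans (sym k+d≡n) (+-comm k d))) (sym (+-suc d k)))

    x⟶y : iterate rowmotion (suc d) x ≡ y
    x⟶y = iterate-rowmotion-initial-wrap 0<k k≤n

    y⟶x : iterate rowmotion (suc k) y ≡ x
    y⟶x = subst (λ t → iterate rowmotion (suc t) y ≡ interval 0 t) (m∸[m∸n]≡n k≤n)
                (iterate-rowmotion-initial-wrap 0<d (m∸n≤m n k))

    period : iterate rowmotion (2 + n) x ≡ x
    period = begin
      iterate rowmotion (2 + n) x                              ≡⟨ cong (λ t → iterate rowmotion t x) (trans 2+n≡d+k (+-comm (suc d) (suc k))) ⟩
      iterate rowmotion (suc k + suc d) x                      ≡⟨ iterate-+ rowmotion (suc k) (suc d) x ⟩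
      iterate rowmotion (suc k) (iterate rowmotion (suc d) x)  ≡⟨ cong (iterate rowmotion (suc k)) x⟶y ⟩
      iterate rowmotion (suc k) y                              ≡⟨ y⟶x ⟩
      x                                                        ∎
      where open ≡-Reasoning

    y-orbit-≢ : ∀ i → i ≤ k → iterate rowmotion i y ≢ x
    y-orbit-≢ zero    _   = interval-≢ (<-≤-trans k<d (m∸n≤m n k)) (z≤n , k<d) (λ (_ , k<k) → <-irrefl refl k<k)
    y-orbit-≢ (suc i) i<k = iterate-rowmotion-initial-≢ (suc i) z<s 0<d 0<k (subst (suc i + d ≤_) k+d≡n (+-monoˡ-≤ d i<k))

    no-return : ∀ j → 0 < j → j < 2 + n → iterate rowmotion j x ≢ x
    no-return j 0<j j<2+n with j ≤? d
    ... | yes j≤d = iterate-rowmotion-initial-≢ j 0<j 0<k 0<k (subst (j + k ≤_) (trans (+-comm d k) k+d≡n) (+-monoˡ-≤ k j≤d))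
    ... | no j≰d  = λ eq → y-orbit-≢ i i≤k (begin
        iterate rowmotion i y                              ≡⟨ cong (iterate rowmotion i) x⟶y ⟨
        iterate rowmotion i (iterate rowmotion (suc d) x)  ≡⟨ iterate-+ rowmotion i (suc d) x ⟨
        iterate rowmotion (i + suc d) x                    ≡⟨ cong (λ t → iterate rowmotion t x) (m∸n+n≡m d<j) ⟩
        iterate rowmotion j x                              ≡⟨ eq ⟩
        x                                                  ∎)
      where
      open ≡-Reasoning
      d<j = ≰⇒> j≰d
      i = j ∸ suc d
      i≤k : i ≤ k
      i≤k = s≤s⁻¹ (+-cancelʳ-< (suc d) i (suc k)
              (subst₂ _<_ (sym (m∸n+n≡m d<j)) (trans 2+n≡d+k (+-comm (suc d) (suc k))) j<2+n))

  orbitSize : IsOrbitSize rowmotion x (2 + n)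
  orbitSize = _ , period , no-return

  cardSum : orbitCardSum rowmotion x (2 + n) ≡ 2 * k * d + n
  cardSum = begin
    orbitCardSum rowmotion x (2 + n)                                ≡⟨ cong (orbitCardSum rowmotion x) 2+n≡d+k ⟩
    orbitCardSum rowmotion x (suc d + suc k)                        ≡⟨ orbitCardSum-+ rowmotion x (suc d) (suc k) ⟩
    orbitCardSum rowmotion x (suc d)
      + orbitCardSum rowmotion (iterate rowmotion (suc d) x) (suc k) ≡⟨ cong₂ _+_ (orbitCardSum-initial 0<k k≤n)
                                                                                 (cong (λ S → orbitCardSum rowmotion S (suc k)) x⟶y) ⟩
    suc d * k + orbitCardSum rowmotion y (suc k)                    ≡⟨ cong (λ t → suc d * k + t) y-cardSum ⟩
    suc d * k + suc k * d                                           ≡⟨ expand k d ⟩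
    2 * k * d + (k + d)                                             ≡⟨ cong (λ t → 2 * k * d + t) k+d≡n ⟩
    2 * k * d + n                                                   ∎
    where
    open ≡-Reasoning
    y-cardSum : orbitCardSum rowmotion y (suc k) ≡ suc k * d
    y-cardSum = subst (λ t → orbitCardSum rowmotion y (suc t) ≡ suc t * d) (m∸[m∸n]≡n k≤n)
                      (orbitCardSum-initial 0<d (m∸n≤m n k))
    expand : ∀ k d → suc d * k + suc k * d ≡ 2 * k * d + (k + d)
    expand = solve-∀

interval-half-orbit : ∀ {n h} → 0 < h → h + h ≡ n →
                      IsOrbitSize rowmotion (interval {n} 0 h) (suc h)
                      × orbitCardSum rowmotion (interval {n} 0 h) (suc h) ≡ suc h * h
interval-half-orbit {n} {h} 0<h h+h≡n = (_ , period , no-return) , cardSum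
  where
  h≤n = subst (h ≤_) h+h≡n (m≤m+n h h)
  n∸h≡h : n ∸ h ≡ h
  n∸h≡h = trans (cong (_∸ h) (sym h+h≡n)) (m+n∸m≡n h h)
  period : iterate rowmotion (suc h) (interval 0 h) ≡ interval 0 h
  period = subst (λ t → iterate rowmotion (suc t) (interval 0 h) ≡ interval 0 t) n∸h≡h (iterate-rowmotion-initial-wrap 0<h h≤n)
  no-return : ∀ j → 0 < j → j < suc h → iterate rowmotion j (interval {n} 0 h) ≢ interval 0 h
  no-return j 0<j j≤h = iterate-rowmotion-initial-≢ j 0<j 0<h 0<h (subst (j + h ≤_) h+h≡n (+-monoˡ-≤ h (s≤s⁻¹ j≤h)))
  cardSum : orbitCardSum rowmotion (interval {n} 0 h) (suc h) ≡ suc h * h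
  cardSum = subst (λ t → orbitCardSum rowmotion (interval {n} 0 h) (suc t) ≡ suc t * h) n∸h≡h (orbitCardSum-initial 0<h h≤n)

rowmotion-⊥ : ∀ {n} → rowmotion {n} ⊥ ≡ ⊤
rowmotion-⊥ {n} = begin
  rowmotion ⊥               ≡⟨ cong rowmotion (interval-empty n n ≤-refl) ⟨
  rowmotion (interval n n)  ≡⟨ rowmotion-wrap n ≤-refl ⟩
  interval 0 n              ≡⟨ interval-full ⟩
  ⊤                         ∎
  where open ≡-Reasoning

rowmotion-⊤ : ∀ {n} → rowmotion {n} ⊤ ≡ ⊥
rowmotion-⊤ {n} = begin
  rowmotion ⊤               ≡⟨ cong rowmotion interval-full ⟨
  rowmotion (interval 0 n)  ≡⟨ rowmotion-wrap 0 z≤n ⟩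
  interval 0 0              ≡⟨ interval-empty 0 0 z≤n ⟩
  ⊥                         ∎
  where open ≡-Reasoning

cross-mul⇒/-≡ : ∀ m n c d → m * suc d ≡ n * suc c → (+ m) / suc c ≡ (+ n) / suc d
cross-mul⇒/-≡ m n c d eq = fromℚᵘ-cong {mkℚᵘ (+ m) c} {mkℚᵘ (+ n) d} (*≡* (trans (sym (pos-* m (suc d))) (trans (cong +_ eq) (pos-* n (suc c)))))

⊥-orbit-average : ∀ {n} → 0 < n →
                  rowmotion {n} ⊥ ≡ ⊤ × IsOrbitSize rowmotion (⊥ {n}) 2 × orbitAverageCard rowmotion (⊥ {n}) 2 ≡ (+ n) / 2
⊥-orbit-average {n} 0<n =
  rowmotion-⊥ , (_ , trans (cong rowmotion rowmotion-⊥) rowmotion-⊤ , no-return) , cong (λ s → (+ s) / 2) cardSum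
  where
  no-return : ∀ j → 0 < j → j < 2 → iterate rowmotion j (⊥ {n}) ≢ ⊥
  no-return 1 _ _ eq = interval-≢ 0<n (z≤n , 0<n) (λ (_ , 0<0) → <-irrefl refl 0<0)
    (trans interval-full (trans (sym rowmotion-⊥) (trans eq (sym (interval-empty 0 0 z≤n)))))
  no-return (suc (suc _)) _ (s≤s (s≤s ()))
  cardSum : orbitCardSum rowmotion (⊥ {n}) 2 ≡ n
  cardSum = cong₂ _+_ (∣⊥∣≡0 n) (trans (cong ∣_∣ (rowmotion-⊥ {n})) (∣⊤∣≡n n))

initialSegment-orbit-average : ∀ {n k} → 0 < k → k + k < n →
                               IsOrbitSize rowmotion (initialSegment {n} k) (2 + n)
                               × orbitAverageCard rowmotion (initialSegment {n} k) (2 + n) ≡ (+ (2 * k * (n ∸ k) + n)) / (2 + n)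
initialSegment-orbit-average {n} {k} 0<k k+k<n =
  subst (λ I → IsOrbitSize rowmotion I (2 + n) × orbitAverageCard rowmotion I (2 + n) ≡ (+ (2 * k * (n ∸ k) + n)) / (2 + n))
    (sym (initialSegment≡interval k))
    (orbitSize , cong (λ s → (+ s) / (2 + n)) cardSum)
  where open InitialIntervalOrbit 0<k k+k<n

initialSegment-half-orbit-average : ∀ {n h} → 0 < n → h + h ≡ n →
                                    IsOrbitSize rowmotion (initialSegment {n} h) (suc h)
                                    × orbitAverageCard rowmotion (initialSegment {n} h) (suc h) ≡ (+ n) / 2
initialSegment-half-orbit-average {h = zero}  () refl
initialSegment-half-orbit-average {n} {h@(suc _)} _ h+h≡n =
  subst (λ I → IsOrbitSize rowmotion I (suc h) × orbitAverageCard rowmotion I (suc h) ≡ (+ n) / 2)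
    (sym (initialSegment≡interval h))
    (proj₁ (interval-half-orbit z<s h+h≡n) ,
     trans (cong (λ s → (+ s) / suc h) (proj₂ (interval-half-orbit z<s h+h≡n)))
           (cross-mul⇒/-≡ (suc h * h) n h 1 (trans (expand h) (cong (_* suc h) h+h≡n))))
  where
  expand : ∀ h → suc h * h * 2 ≡ (h + h) * suc h
  expand = solve-∀

cardinality-not-homomesic : ∀ n → 3 ≤ n → ¬ CardHomomesic n
cardinality-not-homomesic n@(suc (suc (suc m))) (s≤s (s≤s (s≤s _))) (c , homomesic) =
  m+1+n≢m _ (trans (sym (expand m)) (normalize-injective-≃ n (2 * 1 * (n ∸ 1) + n) 2 (2 + n) averages-agree))
  where
  open ≡-Reasoning
  empty-orbit = ⊥-orbit-average {n} z<s
  unit-orbit = initialSegment-orbit-average {n} {1} z<s (s≤s (s≤s (s≤s z≤n)))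
  ⊥-closed : IsIntervalClosed (⊥ {n})
  ⊥-closed = subst IsIntervalClosed (interval-empty 0 0 z≤n) (interval-isIntervalClosed 0 0)
  unit-closed : IsIntervalClosed (initialSegment {n} 1)
  unit-closed = subst IsIntervalClosed (sym (initialSegment≡interval 1)) (interval-isIntervalClosed 0 1)
  averages-agree : (+ n) / 2 ≡ (+ (2 * 1 * (n ∸ 1) + n)) / (2 + n)
  averages-agree = begin
    (+ n) / 2                                                     ≡⟨ proj₂ (proj₂ empty-orbit) ⟨
    orbitAverageCard rowmotion (⊥ {n}) 2                          ≡⟨ homomesic ⊥ ⊥-closed 2 (proj₁ (proj₂ empty-orbit)) ⟩
    c                                                             ≡⟨ homomesic (initialSegment 1) unit-closed (2 + n) (proj₁ unit-orbit) ⟨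
    orbitAverageCard rowmotion (initialSegment {n} 1) (2 + n)     ≡⟨ proj₂ unit-orbit ⟩
    (+ (2 * 1 * (n ∸ 1) + n)) / (2 + n)                           ∎
  -- the averages n / 2 and (3n - 2) / (n + 2) differ by (n - 2)² / (2(n + 2))
  expand : ∀ m → (3 + m) * (2 + (3 + m)) ≡ (2 * 1 * (2 + m) + (3 + m)) * 2 + suc m * suc m
  expand = solve-∀

proposition3p16 : ∀ (n : ℕ) → 3 ≤ n →
    ¬ CardHomomesic n
    × (rowmotion {n} ⊥ ≡ ⊤ × IsOrbitSize (rowmotion {n}) ⊥ 2
    × orbitAverageCard (rowmotion {n}) ⊥ 2 ≡ (+ n) / 2)
    × (∀ (k : ℕ) → 1 ≤ k → 2 * k < n →
    IsOrbitSize (rowmotion {n}) (initialSegment k) (2 + n)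
    × orbitAverageCard (rowmotion {n}) (initialSegment k) (2 + n)
    ≡ (+ (2 * k * (n ∸ k) + n)) / (2 + n))
    × (∀ (h : ℕ) → n ≡ 2 * h →
    IsOrbitSize (rowmotion {n}) (initialSegment h) (suc h)
    × orbitAverageCard (rowmotion {n}) (initialSegment h) (suc h) ≡ (+ n) / 2)
proposition3p16 n 3≤n =
    cardinality-not-homomesic n 3≤n
  , ⊥-orbit-average 0<n
  , (λ k 0<k 2k<n → initialSegment-orbit-average 0<k (subst (_< n) (2*m≡m+m k) 2k<n))
  , (λ h n≡2h → initialSegment-half-orbit-average 0<n (sym (trans n≡2h (2*m≡m+m h))))
  where
  0<n = <-≤-trans z<s 3≤n
  2*m≡m+m : ∀ m → 2 * m ≡ m + m
  2*m≡m+m m = cong (λ t → m + t) (+-identityʳ m)
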